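{- Let $(x,y)$ be a position of the game Euclid with $x>y$, and let $\phi=(1+\sqrt5)/2$. (i) If $(x,y)$ is a P-position, then the (unique) move from it, to $(x',y)$, satisfies $x'/x\le 1-1/\phi$. (ii) If $(x,y)$ is an N-position, then the (unique) move from it to a P-position $(x',y)$ satisfies $x'/x\le \phi-1$.
   Context: Game Euclid: positions are pairs $(x,y)$ of positive integers; $(x,y)$ is terminal iff $x=y$. Otherwise, with $x>y$ say, a move is $(x,y)\to(x-\ell y,y)$ for any integer $\ell>0$ with $x-\ell y>0$ (symmetrically if $y>x$). A player unable to move loses. P-positions are those from which the player to move loses under optimal play, N-positions the others. Known facts: $(x,y)$ is a P-position iff $x<\phi y$ and $y<\phi x$; from a P-position there is exactly one move; from an N-position there is exactly one move to a P-position. -}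

module Defs where

open import Data.Nat using (ℕ; zero; suc; _+_; _*_; _∸_; _≤_; _<_)
open import Data.Product using (_×_; _,_)
open import Relation.Nullary using (¬_)

-- Positions of Euclid: pairs of positive integers (positivity is
-- enforced by the move relation / the theorem's hypotheses).
Pos : Set
Pos = ℕ × ℕ

data Move : Pos → Pos → Set where
  left  : ∀ {x y ℓ} → 0 < y → 1 ≤ ℓ → ℓ * y < x → Move (x , y) (x ∸ ℓ * y , y)
  right : ∀ {x y ℓ} → 0 < x → 1 ≤ ℓ → ℓ * x < y → Move (x , y) (x , y ∸ ℓ * x)

data IsP : Pos → Set
data IsN : Pos → Set

data IsP where
  isP : ∀ {p} → (∀ {q} → Move p q → IsN q) → IsP p

data IsN where
  isN : ∀ {p q} → Move p q → IsP q → IsN p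

-- Comparisons of a nonnegative rational a/b (b > 0) with φ = (1+√5)/2,
-- using that for t ≥ 0: t < φ ⇔ t² < t + 1 (φ is the positive root of t² = t + 1).
-- a/b ≤ φ  (φ is irrational, so this coincides with a/b < φ)
_/_≤φ : ℕ → ℕ → Set
a / b ≤φ = a * a ≤ a * b + b * b

φ≤_/_ : ℕ → ℕ → Set
φ≤ a / b = ¬ (a * a < a * b + b * b)

{-# OPTIONS --safe #-}
-- The P-positions are the pairs with x < φ y and y < φ x. Since 1/φ = φ − 1, subtracting
-- ℓ y ≥ y from such an x leaves x′ with φ x′ < y, while from x ≥ φ y repeatedly subtracting
-- y reaches such a pair; irrationality of φ makes the two regions complementary. From a
-- P-position the amount m = x − x′ ≥ y removed satisfies x < φ m, which is (i); for a move
-- to a P-position, φ x′ = x′ + x′/φ < x′ + y ≤ x, which is (ii).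
module Submission where

open import Defs
open import Data.Nat using (ℕ; zero; suc; _+_; _*_; _∸_; _<_; _≤_; z≤n; s≤s; z<s; _≤?_; _<?_)
open import Data.Nat.Properties
open import Data.Nat.Induction using (<-wellFounded)
open import Data.Nat.Tactic.RingSolver using (solve-∀)
open import Data.Product using (_×_; _,_; ∃; ∃₂; proj₁; proj₂; swap)
open import Function using (_∘_)
open import Induction.WellFounded using (Acc; acc)
open import Relation.Nullary using (¬_; yes; no; contradiction)
open import Relation.Nullary.Decidable using (decidable-stable)
open import Relation.Binary.PropositionalEquality
  using (_≡_; _≢_; refl; sym; trans; cong; subst; subst₂)

_/_<φ : ℕ → ℕ → Set
a / b <φ = a * a < a * b + b * b

φ<_/_ : ℕ → ℕ → Set
φ< a / b = a * b + b * b < a * a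

φ<⇒φ≤ : ∀ {a b} → φ< a / b → φ≤ a / b
φ<⇒φ≤ = <-asym

≤⇒<φ : ∀ {a b} → 0 < b → a ≤ b → a / b <φ
≤⇒<φ {a} {b@(suc _)} _ a≤b = begin-strict
  a * a          ≤⟨ *-monoʳ-≤ a a≤b ⟩
  a * b          <⟨ m<m+n (a * b) z<s ⟩
  a * b + b * b  ∎
  where open ≤-Reasoning

<φ⇒0< : ∀ {a b} → a / b <φ → 0 < b
<φ⇒0< {a} {zero} a/0<φ rewrite *-zeroʳ a = contradiction a/0<φ n≮0
<φ⇒0< {b = suc _} _ = z<s

<φ-monoʳ : ∀ {a b c} → a / b <φ → b ≤ c → a / c <φ
<φ-monoʳ {a} a/b<φ b≤c = <-≤-trans a/b<φ (+-mono-≤ (*-monoʳ-≤ a b≤c) (*-mono-≤ b≤c b≤c))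

φ<-antitoneʳ : ∀ {a b c} → φ< a / c → b ≤ c → φ< a / b
φ<-antitoneʳ {a} φ<a/c b≤c = ≤-<-trans (+-mono-≤ (*-monoʳ-≤ a b≤c) (*-mono-≤ b≤c b≤c)) φ<a/c

-- As 1/φ = φ − 1, the number 1 + t is below φ exactly when 1/t is above φ.
private
  shift-num : ∀ a b → (b + a) * (b + a) ≡ (b * a + a * a) + (a * b + b * b)
  shift-num = solve-∀

  shift-den : ∀ a b → (b + a) * b + b * b ≡ b * b + (a * b + b * b)
  shift-den = solve-∀

+<φ⇒φ< : ∀ {a b} → (b + a) / b <φ → φ< b / a
+<φ⇒φ< {a} {b} h = +-cancelʳ-< (a * b + b * b) _ _ (subst₂ _<_ (shift-num a b) (shift-den a b) h)

φ≤+⇒≤φ : ∀ {a b} → φ≤ (b + a) / b → b / a ≤φ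
φ≤+⇒≤φ {a} {b} h = ≮⇒≥ λ φ<b/a →
  h (subst₂ _<_ (sym (shift-num a b)) (sym (shift-den a b)) (+-monoˡ-< (a * b + b * b) φ<b/a))

φ≤⇒+≤φ : ∀ {a b} → φ≤ b / a → (b + a) / b ≤φ
φ≤⇒+≤φ {a} {b} h =
  subst₂ _≤_ (sym (shift-num a b)) (sym (shift-den a b)) (+-monoˡ-≤ (a * b + b * b) (≮⇒≥ h))

-- If a = φ b then b = φ (a − b): an infinite descent in the numerator.
φ-irrational : ∀ {a b} → 0 < a → a * a ≢ a * b + b * b
φ-irrational = descent (<-wellFounded _)
  where
  descend : ∀ b c → (b + c) * (b + c) ≡ (b + c) * b + b * b → b * b ≡ b * c + c * c
  descend b c eq = sym (+-cancelʳ-≡ (b * b + b * c) _ _ (trans (sym (lhs b c)) (trans eq (rhs b c))))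
    where
    lhs : ∀ b c → (b + c) * (b + c) ≡ (b * c + c * c) + (b * b + b * c)
    lhs = solve-∀
    rhs : ∀ b c → (b + c) * b + b * b ≡ b * b + (b * b + b * c)
    rhs = solve-∀

  descent : ∀ {a b} → Acc _<_ a → 0 < a → a * a ≢ a * b + b * b
  descent {zero} _ () _
  descent {suc a} {zero} _ _ eq rewrite *-zeroʳ a = contradiction eq λ ()
  descent {a} {b@(suc _)} (acc rs) a>0 eq with a ≤? b
  ... | yes a≤b = <-irrefl eq (≤⇒<φ z<s a≤b)
  ... | no a≰b with c , refl ← m≤n⇒∃[o]m+o≡n (≰⇒≥ a≰b) =
    descent {b} {c} (rs (≰⇒> a≰b)) z<s (descend b c eq)

≤φ⇒<φ : ∀ {a b} → 0 < a → a / b ≤φ → a / b <φ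
≤φ⇒<φ a>0 a/b≤φ = ≤∧≢⇒< a/b≤φ (φ-irrational a>0)

<φ⇒φ< : ∀ {a b c} → a / b <φ → b + a ≤ c → φ< c / a
<φ⇒φ< {a} {b} {c} a/b<φ b+a≤c = begin-strict
  c * a + a * a           <⟨ +-monoʳ-< (c * a) a/b<φ ⟩
  c * a + (a * b + b * b) ≡⟨ cong (c * a +_) (+-comm (a * b) (b * b)) ⟩
  c * a + (b * b + a * b) ≡⟨ cong (c * a +_) (sym (*-distribʳ-+ b b a)) ⟩
  c * a + (b + a) * b     ≤⟨ +-monoʳ-≤ (c * a) (*-monoˡ-≤ b b+a≤c) ⟩
  c * a + c * b           ≡⟨ +-comm (c * a) (c * b) ⟩
  c * b + c * a           ≡⟨ sym (*-distribˡ-+ c b a) ⟩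
  c * (b + a)             ≤⟨ *-monoʳ-≤ c b+a≤c ⟩
  c * c                   ∎
  where open ≤-Reasoning

<φ⇒φ≤+ : ∀ {a b c} → a / b <φ → b ≤ c → φ≤ (a + c) / a
<φ⇒φ≤+ {a} {b} {c} a/b<φ b≤c a+c/a<φ =
  φ<⇒φ≤ {a} (+<φ⇒φ< {c} {a} a+c/a<φ) (<φ-monoʳ {a} {b} a/b<φ b≤c)

φ≤-after-subtraction : ∀ {a b ℓ} → a / b <φ → 1 ≤ ℓ → ℓ * b < a → φ≤ b / (a ∸ ℓ * b)
φ≤-after-subtraction {a} {b} {suc k} a/b<φ (s≤s z≤n) ℓb<a =
  φ<⇒φ≤ {b} (φ<-antitoneʳ {b} (+<φ⇒φ< {k * b + a′} {b} (subst (_/ b <φ) a≡ a/b<φ))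
                            (m≤n+m a′ (k * b)))
  where
  a′ = a ∸ suc k * b
  a≡ : a ≡ b + (k * b + a′)
  a≡ = trans (sym (m+[n∸m]≡n (<⇒≤ ℓb<a))) (+-assoc b (k * b) a′)

φ≤⇒balanced-remainder : ∀ {x y} → Acc _<_ x → 0 < y → φ≤ x / y →
  ∃₂ λ ℓ x′ → x ≡ suc ℓ * y + x′ × x′ / y <φ × y / x′ <φ
φ≤⇒balanced-remainder {x} {y} (acc rs) y>0 φ≤x/y
  with x₁ , refl ← m≤n⇒∃[o]m+o≡n (≰⇒≥ {x} {y} (φ≤x/y ∘ ≤⇒<φ y>0))
  with x₁ * x₁ <? x₁ * y + y * y
... | yes x₁/y<φ =
  0 , x₁ , cong (_+ x₁) (sym (*-identityˡ y)) , x₁/y<φ , ≤φ⇒<φ {y} {x₁} y>0 (φ≤+⇒≤φ {x₁} {y} φ≤x/y)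
... | no φ≤x₁/y
  with ℓ , x′ , refl , balanced ← φ≤⇒balanced-remainder (rs (m<n+m x₁ y>0)) y>0 φ≤x₁/y =
  suc ℓ , x′ , sym (+-assoc y (suc ℓ * y) x′) , balanced

Move-swap : ∀ {p q} → Move p q → Move (swap p) (swap q)
Move-swap (left y>0 ℓ≥1 ℓy<x)  = right y>0 ℓ≥1 ℓy<x
Move-swap (right x>0 ℓ≥1 ℓx<y) = left x>0 ℓ≥1 ℓx<y

IsP-swap : ∀ {p} → IsP p → IsP (swap p)
IsN-swap : ∀ {p} → IsN p → IsN (swap p)
IsP-swap (isP next) = isP λ m → IsN-swap (next (Move-swap m))
IsN-swap (isN m P) = isN (Move-swap m) (IsP-swap P)

IsP⇒¬IsN : ∀ {p} → IsP p → ¬ IsN p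
IsP⇒¬IsN (isP next) (isN m P) = IsP⇒¬IsN P (next m)

move-left : ∀ {x′ y} ℓ → 0 < y → 0 < x′ → Move (suc ℓ * y + x′ , y) (x′ , y)
move-left {x′} {y} ℓ y>0 x′>0 =
  subst (λ z → Move (suc ℓ * y + x′ , y) (z , y)) (m+n∸m≡n (suc ℓ * y) x′)
    (left {ℓ = suc ℓ} y>0 (s≤s z≤n) (m<m+n (suc ℓ * y) x′>0))

Move-fixingʳ : ∀ {x y q} → Move (x , y) q → proj₂ q ≡ y →
  ∃ λ m → y ≤ m × x ≡ m + proj₁ q
Move-fixingʳ (left {y = y} {ℓ = suc ℓ} _ (s≤s z≤n) ℓy<x) _ =
  _ , m≤m+n y (ℓ * y) , sym (m+[n∸m]≡n (<⇒≤ ℓy<x))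
Move-fixingʳ (right {x} {ℓ = suc ℓ} x>0 (s≤s z≤n) ℓx<y) y∸ℓx≡y =
  contradiction y∸ℓx≡y (<⇒≢ (∸-monoʳ-< (≤-trans x>0 (m≤m+n x (ℓ * x))) (<⇒≤ ℓx<y)))

∸-< : ∀ {a b ℓ} → 0 < b → 1 ≤ ℓ → ℓ * b < a → a ∸ ℓ * b < a
∸-< b>0 ℓ≥1 ℓb<a = ∸-monoʳ-< (*-mono-≤ ℓ≥1 b>0) (<⇒≤ ℓb<a)

φ-balanced⇒IsP : ∀ {x y} → Acc _<_ (x + y) → x / y <φ → y / x <φ → IsP (x , y)
φ≤⇒IsN : ∀ {x y} → Acc _<_ (x + y) → 0 < y → φ≤ x / y → IsN (x , y)

φ-balanced⇒IsP {x} {y} (acc rs) x/y<φ y/x<φ = isP λ where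
  (left y>0 ℓ≥1 ℓy<x) → IsN-swap (φ≤⇒IsN
    (rs (<-≤-trans (+-monoʳ-< y (∸-< y>0 ℓ≥1 ℓy<x)) (≤-reflexive (+-comm y x))))
    (m<n⇒0<n∸m ℓy<x) (φ≤-after-subtraction x/y<φ ℓ≥1 ℓy<x))
  (right x>0 ℓ≥1 ℓx<y) → φ≤⇒IsN
    (rs (+-monoʳ-< x (∸-< x>0 ℓ≥1 ℓx<y)))
    (m<n⇒0<n∸m ℓx<y) (φ≤-after-subtraction y/x<φ ℓ≥1 ℓx<y)

φ≤⇒IsN {x} {y} (acc rs) y>0 φ≤x/y
  with ℓ , x′ , refl , x′/y<φ , y/x′<φ ← φ≤⇒balanced-remainder (<-wellFounded x) y>0 φ≤x/y =
  isN (move-left ℓ y>0 (<φ⇒0< {y} y/x′<φ))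
      (φ-balanced⇒IsP (rs (+-monoˡ-< y (m<n+m x′ (*-mono-≤ {1} {suc ℓ} (s≤s z≤n) y>0)))) x′/y<φ y/x′<φ)

IsP⇒<φ : ∀ {x y} → 0 < y → IsP (x , y) → x / y <φ
IsP⇒<φ y>0 P = decidable-stable (_ <? _) (IsP⇒¬IsN P ∘ φ≤⇒IsN (<-wellFounded _) y>0)

P-move-bound : ∀ {x y x′} → 0 < y → IsP (x , y) → Move (x , y) (x′ , y) → φ≤ (2 * x ∸ x′) / x
P-move-bound {y = y} {x′ = x′} y>0 P mv with m , y≤m , refl ← Move-fixingʳ mv refl =
  subst (λ a → φ≤ a / (m + x′)) (sym double-∸)
    (<φ⇒φ≤+ {m + x′} {y} (IsP⇒<φ y>0 P) y≤m)
  where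
  double : ∀ m x′ → 2 * (m + x′) ≡ ((m + x′) + m) + x′
  double = solve-∀

  double-∸ : 2 * (m + x′) ∸ x′ ≡ (m + x′) + m
  double-∸ = trans (cong (_∸ x′) (double m x′)) (m+n∸n≡m ((m + x′) + m) x′)

N-move-bound : ∀ {x y x′} → 0 < y → Move (x , y) (x′ , y) → IsP (x′ , y) → (x′ + x) / x ≤φ
N-move-bound {y = y} {x′ = x′} y>0 mv P′ with m , y≤m , refl ← Move-fixingʳ mv refl =
  subst (_/ (m + x′) ≤φ) (+-comm (m + x′) x′)
    (φ≤⇒+≤φ {x′} {m + x′} (φ<⇒φ≤ {m + x′} (<φ⇒φ< {x′} {y} (IsP⇒<φ y>0 P′) (+-monoˡ-≤ x′ y≤m))))

mainTheorem10 : ∀ (x y x′ : ℕ) → 0 < y → y < x →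
    -- (i) x′/x ≤ 1 − 1/φ = 2 − φ  ⇔  φ ≤ (2x − x′)/x
    (IsP (x , y) → Move (x , y) (x′ , y) → φ≤ (2 * x ∸ x′) / x)
    ×
    -- (ii) x′/x ≤ φ − 1  ⇔  (x′ + x)/x ≤ φ
    (IsN (x , y) → Move (x , y) (x′ , y) → IsP (x′ , y) → (x′ + x) / x ≤φ)
-- y < x and IsN (x , y) are implied by a move (x , y) → (x′ , y) to a P-position.
mainTheorem10 x y x′ y>0 _ = P-move-bound y>0 , λ _ → N-move-bound y>0
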